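{- If $G$ is not a Roman graph, then $\gamma_R(\mu(G))=\gamma_R(G)+2$.
   Context: All graphs are finite and simple. A dominating set of $G$ is a set $S\subseteq V(G)$ such that every vertex outside $S$ has a neighbor in $S$; $\gamma(G)$ is the minimum size of a dominating set. A Roman dominating function (RDF) of $G=(V,E)$ is a function $f:V\to\{0,1,2\}$ such that every vertex $v$ with $f(v)=0$ has a neighbor $w$ with $f(w)=2$; its weight is $\sum_v f(v)$ and $\gamma_R(G)$ is the minimum weight of an RDF. $G$ is a Roman graph if $\gamma_R(G)=2\gamma(G)$. The Mycielskian $\mu(G)$ of $G$ with $V(G)=\{v_1^0,\ldots,v_n^0\}$ has vertex set $\{v_j^0\}\cup\{v_j^1\}\cup\{u\}$ and edge set $E(G)\cup\{v_j^0v_{j'}^1 : v_j^0v_{j'}^0\in E(G)\}\cup\{v_j^1u: 1\leq j\leq n\}$. -}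

module Defs where

open import Data.Bool using (Bool; true; false; T)
open import Data.Nat using (ℕ; zero; suc; _+_; _*_; _≤_)
open import Data.Fin using (Fin; zero; suc; splitAt)
open import Data.Fin.Subset using (Subset; _∈_; _∉_; ∣_∣)
open import Data.Sum using (_⊎_; inj₁; inj₂)
open import Data.Product using (Σ; ∃; _×_; _,_)
open import Data.List using (List; map)
open import Data.Nat.ListAction using (sum)
open import Data.List using () renaming (allFin to allFinL)
open import Relation.Binary.PropositionalEquality using (_≡_)
open import Relation.Nullary using (¬_)

record Graph (n : ℕ) : Set where
  field
    adj   : Fin n → Fin n → Bool
    sym   : ∀ i j → adj i j ≡ adj j i
    irrefl : ∀ i → adj i i ≡ false
open Graph public

Adj : ∀ {n} → Graph n → Fin n → Fin n → Set
Adj G i j = T (adj G i j)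

IsDominating : ∀ {n} → Graph n → Subset n → Set
IsDominating {n} G S = ∀ v → v ∉ S → ∃ λ w → w ∈ S × Adj G v w

IsDominationNumber : ∀ {n} → Graph n → ℕ → Set
IsDominationNumber {n} G k =
  (Σ (Subset n) λ S → IsDominating G S × ∣ S ∣ ≡ k) ×
  (∀ S → IsDominating G S → k ≤ ∣ S ∣)

IsRDF : ∀ {n} → Graph n → (Fin n → ℕ) → Set
IsRDF {n} G f =
  (∀ v → f v ≤ 2) ×
  (∀ v → f v ≡ 0 → ∃ λ w → Adj G v w × f w ≡ 2)

weight : ∀ {n} → (Fin n → ℕ) → ℕ
weight {n} f = sum (map f (allFinL n))

IsRomanDominationNumber : ∀ {n} → Graph n → ℕ → Set
IsRomanDominationNumber {n} G k =
  (Σ (Fin n → ℕ) λ f → IsRDF G f × weight f ≡ k) ×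
  (∀ f → IsRDF G f → k ≤ weight f)

-- Mycielskian. Vertices of μ(G) are Fin (suc (n + n)):
--   zero           ↦ u
--   suc i, i < n   ↦ v_i^0   (splitAt gives inj₁ i)
--   suc (n + i)    ↦ v_i^1   (splitAt gives inj₂ i)
data MVertex (n : ℕ) : Set where
  u   : MVertex n
  v0  : Fin n → MVertex n
  v1  : Fin n → MVertex n

view : ∀ {n} → Fin (suc (n + n)) → MVertex n
view zero = u
view {n} (suc i) with splitAt n i
... | inj₁ j = v0 j
... | inj₂ j = v1 j

madj : ∀ {n} → Graph n → MVertex n → MVertex n → Bool
madj G u u = false
madj G u (v0 j) = false
madj G u (v1 j) = true
madj G (v0 j) u = false
madj G (v0 j) (v0 k) = adj G j k
madj G (v0 j) (v1 k) = adj G j k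
madj G (v1 j) u = true
madj G (v1 j) (v0 k) = adj G j k
madj G (v1 j) (v1 k) = false

madj-sym : ∀ {n} (G : Graph n) x y → madj G x y ≡ madj G y x
madj-sym G u u = _≡_.refl
madj-sym G u (v0 j) = _≡_.refl
madj-sym G u (v1 j) = _≡_.refl
madj-sym G (v0 j) u = _≡_.refl
madj-sym G (v0 j) (v0 k) = sym G j k
madj-sym G (v0 j) (v1 k) = sym G j k
madj-sym G (v1 j) u = _≡_.refl
madj-sym G (v1 j) (v0 k) = sym G j k
madj-sym G (v1 j) (v1 k) = _≡_.refl

madj-irr : ∀ {n} (G : Graph n) x → madj G x x ≡ false
madj-irr G u = _≡_.refl
madj-irr G (v0 j) = irrefl G j
madj-irr G (v1 j) = _≡_.refl

mycielskian : ∀ {n} → Graph n → Graph (suc (n + n))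
mycielskian G = record
  { adj = λ i j → madj G (view i) (view j)
  ; sym = λ i j → madj-sym G (view i) (view j)
  ; irrefl = λ i → madj-irr G (view i)
  }

-- A minimum RDF f of G, extended by 2 on u and 0 on every v¹, shows γR(μG) ≤ γR(G) + 2.
-- Conversely, let h be an RDF of μG with labels a on the v⁰, b on the v¹ and c on u.
-- Merging the two labels of each vertex j of G into α j = max (a j) (b j if b j = 2 else 0)
-- and β j = max (b j) (a j if a j = 2 else 0) gives functions of weight at most Σ(a + b);
-- α is always Roman, and β is Roman as soon as c ≠ 2. If c = 2, α gives γR(G) ≤ w(h) − 2.
-- Otherwise the supports of α and β both dominate G and together weigh at most Σ(a + b),
-- so 2γ(G) ≤ Σ(a + b), while γR(G) < 2γ(G) because G is not Roman; this settles c = 1.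
-- If c = 0, then u forces some b t = 2: if a t > 0 the count 2γ(G) ≤ Σ(a + b) has slack at t,
-- and if a t = 0, then β stays Roman after relabelling t by 0, which saves 2.

module Submission where

open import Defs hiding (sym)
open import Data.Nat using (ℕ; zero; suc; _+_; _*_; _≤_; _<_; _⊔_; _⊓_; _≤ᵇ_; z≤n; s≤s)
open import Data.Nat.Properties
open import Data.Nat.ListAction using () renaming (sum to sumˡ)
open import Algebra.Properties.CommutativeMonoid.Sum +-0-commutativeMonoid
  using (sum; sum-cong-≗; ∑-distrib-+; sum-remove)
open import Algebra.Properties.Semiring.Sum +-*-semiring using (*-distribˡ-sum)
open import Algebra.Properties.CommutativeSemigroup +-commutativeSemigroup using (xy∙z≈xz∙y)
open import Data.Bool using (true; false; T; if_then_else_)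
open import Data.Empty using (⊥-elim)
open import Data.Fin using (Fin; zero; suc; _↑ˡ_; _↑ʳ_; splitAt; punchIn) renaming (_≟_ to _≟ᶠ_)
open import Data.Fin.Properties using (splitAt-↑ˡ; splitAt-↑ʳ; splitAt⁻¹-↑ˡ; splitAt⁻¹-↑ʳ; punchInᵢ≢i)
open import Data.Fin.Subset using (Subset; _∈_; ∣_∣)
open import Data.List using () renaming (tabulate to tabulateˡ)
open import Data.List.Properties using (map-tabulate)
open import Data.Product using (∃; _×_; _,_; proj₁; proj₂)
open import Data.Sum using (_⊎_; inj₁; inj₂; swap)
open import Data.Vec using ([]; _∷_; lookup; tabulate)
open import Data.Vec.Properties using (lookup⇒[]=; []=⇒lookup; lookup∘tabulate)
open import Data.Vec.Functional using (updateAt)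
open import Data.Vec.Functional.Properties using (updateAt-updates; updateAt-minimal)
open import Function using (_∘_; id; const; case_of_)
open import Relation.Binary.PropositionalEquality
  using (_≡_; _≢_; refl; sym; trans; cong; cong₂; subst; module ≡-Reasoning)
open import Relation.Nullary using (¬_; yes; no)

sumˡ-tabulate : ∀ {n} (f : Fin n → ℕ) → sumˡ (tabulateˡ f) ≡ sum f
sumˡ-tabulate {zero}  f = refl
sumˡ-tabulate {suc n} f = cong (f zero +_) (sumˡ-tabulate (f ∘ suc))

weight≡sum : ∀ {n} (f : Fin n → ℕ) → weight f ≡ sum f
weight≡sum f = trans (cong sumˡ (map-tabulate id f)) (sumˡ-tabulate f)

sum-mono-≤ : ∀ {n} {f g : Fin n → ℕ} → (∀ i → f i ≤ g i) → sum f ≤ sum g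
sum-mono-≤ {zero}  f≤g = z≤n
sum-mono-≤ {suc n} f≤g = +-mono-≤ (f≤g zero) (sum-mono-≤ (f≤g ∘ suc))

sum-mono-≤-at : ∀ {n k} {f g : Fin n → ℕ} (t : Fin n) →
                (∀ i → f i ≤ g i) → f t + k ≤ g t → sum f + k ≤ sum g
sum-mono-≤-at {suc n} {k} {f} {g} t f≤g ft+k≤gt = begin
  sum f + k                          ≡⟨ cong (_+ k) (sum-remove {i = t} f) ⟩
  f t + sum (f ∘ punchIn t) + k      ≡⟨ xy∙z≈xz∙y (f t) _ k ⟩
  f t + k + sum (f ∘ punchIn t)      ≤⟨ +-mono-≤ ft+k≤gt (sum-mono-≤ (f≤g ∘ punchIn t)) ⟩
  g t + sum (g ∘ punchIn t)          ≡⟨ sum-remove {i = t} g ⟨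
  sum g                              ∎
  where open ≤-Reasoning

sum-split : ∀ m n (f : Fin (m + n) → ℕ) →
            sum f ≡ sum (f ∘ (_↑ˡ n)) + sum (f ∘ (m ↑ʳ_))
sum-split zero    n f = refl
sum-split (suc m) n f =
  trans (cong (f zero +_) (sum-split m n (f ∘ suc))) (sym (+-assoc (f zero) _ _))

sum-updateAt-0 : ∀ {n} (f : Fin n → ℕ) (t : Fin n) →
                 sum (updateAt f t (const 0)) + f t ≡ sum f
sum-updateAt-0 {suc n} f t = begin
  sum f₀ + f t                       ≡⟨ cong (_+ f t) (sum-remove {i = t} f₀) ⟩
  f₀ t + sum (f₀ ∘ punchIn t) + f t  ≡⟨ cong (λ x → x + sum (f₀ ∘ punchIn t) + f t) (updateAt-updates t f) ⟩
  sum (f₀ ∘ punchIn t) + f t         ≡⟨ cong (_+ f t) (sum-cong-≗ off-t) ⟩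
  sum (f ∘ punchIn t) + f t          ≡⟨ +-comm _ (f t) ⟩
  f t + sum (f ∘ punchIn t)          ≡⟨ sum-remove {i = t} f ⟨
  sum f                              ∎
  where
  open ≡-Reasoning
  f₀ = updateAt f t (const 0)
  off-t : ∀ i → f₀ (punchIn t i) ≡ f (punchIn t i)
  off-t i = updateAt-minimal (punchIn t i) t f (punchInᵢ≢i t i)

adj⇒≢ : ∀ {n} (G : Graph n) {v w} → Adj G v w → v ≢ w
adj⇒≢ G {v} v~v refl = subst T (irrefl G v) v~v

∣S∣≡sum : ∀ {n} (S : Subset n) → ∣ S ∣ ≡ sum (λ v → if lookup S v then 1 else 0)
∣S∣≡sum []          = refl
∣S∣≡sum (true  ∷ S) = cong suc (∣S∣≡sum S)
∣S∣≡sum (false ∷ S) = ∣S∣≡sum S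

support : ∀ {n} → (Fin n → ℕ) → Subset n
support f = tabulate (λ v → 1 ≤ᵇ f v)

∈-support : ∀ {n} (f : Fin n → ℕ) {v k} → f v ≡ suc k → v ∈ support f
∈-support f {v} fv≡1+k = lookup⇒[]= v _ (trans (lookup∘tabulate _ v) (cong (1 ≤ᵇ_) fv≡1+k))

∣support∣ : ∀ {n} (f : Fin n → ℕ) → ∣ support f ∣ ≡ sum (λ v → 1 ⊓ f v)
∣support∣ {zero}  f = refl
∣support∣ {suc n} f with f zero
... | zero  = ∣support∣ (f ∘ suc)
... | suc _ = cong suc (∣support∣ (f ∘ suc))

support-dominating : ∀ {n} (G : Graph n) {f} → IsRDF G f → IsDominating G (support f)
support-dominating G {f} (_ , f-zero) v v∉S with f v in fv
... | zero  = let (w , v~w , fw≡2) = f-zero v fv in w , ∈-support f fw≡2 , v~w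
... | suc _ = ⊥-elim (v∉S (∈-support f fv))

γ≤∣support∣ : ∀ {n} {G : Graph n} {g f} → IsDominationNumber G g → IsRDF G f →
              g ≤ sum (λ v → 1 ⊓ f v)
γ≤∣support∣ {G = G} {f = f} (_ , minimal) f-rdf =
  subst (_ ≤_) (∣support∣ f) (minimal (support f) (support-dominating G f-rdf))

-- Put 2 on a minimum dominating set.
γR≤2γ : ∀ {n} {G : Graph n} {g r} → IsDominationNumber G g → IsRomanDominationNumber G r →
        r ≤ 2 * g
γR≤2γ {n} {G} {g} ((S , S-dom , ∣S∣≡g) , _) (_ , minimal) =
  subst (_ ≤_) weight≡2g (minimal f (f≤2 , f-zero))
  where
  f : Fin n → ℕ
  f v = 2 * (if lookup S v then 1 else 0)
  f≤2 : ∀ v → f v ≤ 2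
  f≤2 v with lookup S v
  ... | true  = ≤-refl
  ... | false = z≤n
  f-zero : ∀ v → f v ≡ 0 → ∃ λ w → Adj G v w × f w ≡ 2
  f-zero v fv≡0 with lookup S v in Sv | fv≡0
  ... | false | _ = let (w , w∈S , v~w) = S-dom v (λ v∈S → case trans (sym ([]=⇒lookup v∈S)) Sv of λ ())
                    in w , v~w , cong (λ b → 2 * (if b then 1 else 0)) ([]=⇒lookup w∈S)
  weight≡2g : weight f ≡ 2 * g
  weight≡2g = begin
    weight f                                     ≡⟨ weight≡sum f ⟩
    sum f                                        ≡⟨ *-distribˡ-sum 2 (λ v → if lookup S v then 1 else 0) ⟨
    2 * sum (λ v → if lookup S v then 1 else 0)  ≡⟨ cong (2 *_) (trans (sym (∣S∣≡sum S)) ∣S∣≡g) ⟩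
    2 * g                                        ∎
    where open ≡-Reasoning

embed : ∀ {n} → MVertex n → Fin (suc (n + n))
embed     u      = zero
embed {n} (v0 j) = suc (j ↑ˡ n)
embed {n} (v1 j) = suc (n ↑ʳ j)

view-embed : ∀ {n} (m : MVertex n) → view (embed m) ≡ m
view-embed     u      = refl
view-embed {n} (v0 j) rewrite splitAt-↑ˡ n j n = refl
view-embed {n} (v1 j) rewrite splitAt-↑ʳ n n j = refl

embed-view : ∀ {n} (x : Fin (suc (n + n))) → embed (view {n} x) ≡ x
embed-view zero = refl
embed-view {n} (suc i) with splitAt n i in split
... | inj₁ j = cong suc (splitAt⁻¹-↑ˡ split)
... | inj₂ j = cong suc (splitAt⁻¹-↑ʳ split)

weight-μ : ∀ {n} (H : MVertex n → ℕ) →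
           weight (λ x → H (view x)) ≡ H u + sum (λ j → H (v0 j) + H (v1 j))
weight-μ {n} H = begin
  weight (λ x → H (view x))                               ≡⟨ weight≡sum (λ x → H (view x)) ⟩
  H u + sum (λ i → H (view (suc i)))                      ≡⟨ cong (H u +_) (sum-split n n (λ i → H (view (suc i)))) ⟩
  H u + (sum (λ (j : Fin n) → H (view (embed (v0 j)))) + sum (λ (j : Fin n) → H (view (embed (v1 j)))))
    ≡⟨ cong (λ s → H u + s) (cong₂ _+_ (sum-cong-≗ (λ j → cong H (view-embed (v0 j)))) (sum-cong-≗ (λ j → cong H (view-embed (v1 j))))) ⟩
  H u + (sum (H ∘ v0) + sum (H ∘ v1))                     ≡⟨ cong (H u +_) (∑-distrib-+ (H ∘ v0) (H ∘ v1)) ⟨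
  H u + sum (λ j → H (v0 j) + H (v1 j))                   ∎
  where open ≡-Reasoning

IsRDFᵐ : ∀ {n} → Graph n → (MVertex n → ℕ) → Set
IsRDFᵐ G H = (∀ m → H m ≤ 2) × (∀ m → H m ≡ 0 → ∃ λ m′ → T (madj G m m′) × H m′ ≡ 2)

IsRDFᵐ⇒IsRDF : ∀ {n} {G : Graph n} {H} → IsRDFᵐ G H → IsRDF (mycielskian G) (λ x → H (view x))
IsRDFᵐ⇒IsRDF {n} {G} {H} (H≤2 , H-zero) = (λ x → H≤2 (view x)) , zero-at
  where
  zero-at : ∀ x → H (view x) ≡ 0 → ∃ λ y → Adj (mycielskian G) x y × H (view y) ≡ 2
  zero-at x Hx≡0 with H-zero (view x) Hx≡0
  ... | m′ , x~m′ , Hm′≡2 rewrite sym (view-embed m′) = embed m′ , x~m′ , Hm′≡2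

IsRDF⇒IsRDFᵐ : ∀ {n} {G : Graph n} {h} → IsRDF (mycielskian G) h → IsRDFᵐ G (h ∘ embed)
IsRDF⇒IsRDFᵐ {n} {G} {h} (h≤2 , h-zero) = h≤2 ∘ embed , zero-at
  where
  zero-at : ∀ m → h (embed m) ≡ 0 → ∃ λ m′ → T (madj G m m′) × h (embed m′) ≡ 2
  zero-at m hm≡0 with h-zero (embed m) hm≡0
  ... | y , m~y , hy≡2 =
    view {n} y , subst (λ m → T (madj G m (view {n} y))) (view-embed m) m~y , trans (cong h (embed-view y)) hy≡2

extend : ∀ {n} → (Fin n → ℕ) → MVertex n → ℕ
extend f u      = 2
extend f (v0 j) = f j
extend f (v1 j) = 0

extend-rdf : ∀ {n} {G : Graph n} {f} → IsRDF G f → IsRDFᵐ G (extend f)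
extend-rdf {G = G} {f} (f≤2 , f-zero) = extend≤2 , extend-zero
  where
  extend≤2 : ∀ m → extend f m ≤ 2
  extend≤2 u      = ≤-refl
  extend≤2 (v0 j) = f≤2 j
  extend≤2 (v1 j) = z≤n
  extend-zero : ∀ m → extend f m ≡ 0 → ∃ λ m′ → T (madj G m m′) × extend f m′ ≡ 2
  extend-zero (v0 j) fj≡0 = let (w , j~w , fw≡2) = f-zero j fj≡0 in v0 w , j~w , fw≡2
  extend-zero (v1 j) _    = u , _ , refl

γR[μ]≤γR+2 : ∀ {n} {G : Graph n} {r r′} → IsRomanDominationNumber G r →
             IsRomanDominationNumber (mycielskian G) r′ → r′ ≤ r + 2
γR[μ]≤γR+2 {n} {r = r} {r′} ((f , f-rdf , weight≡r) , _) (_ , minimal) =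
  subst (r′ ≤_) weight≡r+2 (minimal _ (IsRDFᵐ⇒IsRDF (extend-rdf f-rdf)))
  where
  weight≡r+2 : weight (λ x → extend f (view {n} x)) ≡ r + 2
  weight≡r+2 = begin
    weight (λ x → extend f (view x))  ≡⟨ weight-μ (extend f) ⟩
    2 + sum (λ j → f j + 0)           ≡⟨ cong (2 +_) (sum-cong-≗ (λ j → +-identityʳ (f j))) ⟩
    2 + sum f                         ≡⟨ cong (2 +_) (trans (sym (weight≡sum f)) weight≡r) ⟩
    2 + r                             ≡⟨ +-comm 2 r ⟩
    r + 2                             ∎
    where open ≡-Reasoning

twoPart : ℕ → ℕ
twoPart 2 = 2
twoPart _ = 0

twoPart≤ : ∀ x → twoPart x ≤ x
twoPart≤ 0                   = z≤n
twoPart≤ 1                   = z≤n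
twoPart≤ 2                   = ≤-refl
twoPart≤ (suc (suc (suc _))) = z≤n

twoPart≤2 : ∀ x → twoPart x ≤ 2
twoPart≤2 0                   = z≤n
twoPart≤2 1                   = z≤n
twoPart≤2 2                   = ≤-refl
twoPart≤2 (suc (suc (suc _))) = z≤n

merge : ℕ → ℕ → ℕ
merge x y = x ⊔ twoPart y

merge≤2 : ∀ {x} y → x ≤ 2 → merge x y ≤ 2
merge≤2 y x≤2 = ⊔-lub x≤2 (twoPart≤2 y)

merge≤+ : ∀ x y → merge x y ≤ x + y
merge≤+ x y = ≤-trans (m⊔n≤m+n x (twoPart y)) (+-monoʳ-≤ x (twoPart≤ y))

merge≡0⇒≡0 : ∀ x y → merge x y ≡ 0 → x ≡ 0
merge≡0⇒≡0 x y merge≡0 = n≤0⇒n≡0 (subst (x ≤_) merge≡0 (m≤m⊔n x (twoPart y)))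

merge≡2 : ∀ {x y} → x ≤ 2 → x ≡ 2 ⊎ y ≡ 2 → merge x y ≡ 2
merge≡2 {y = y} _   (inj₁ refl) = m≥n⇒m⊔n≡m (twoPart≤2 y)
merge≡2         x≤2 (inj₂ refl) = m≤n⇒m⊔n≡n x≤2

merge-rdf : ∀ {n} (G : Graph n) {x y : Fin n → ℕ} → (∀ v → x v ≤ 2) →
            (∀ v → x v ≡ 0 → ∃ λ w → Adj G v w × (x w ≡ 2 ⊎ y w ≡ 2)) →
            IsRDF G (λ v → merge (x v) (y v))
merge-rdf G {x} {y} x≤2 x-zero =
  (λ v → merge≤2 (y v) (x≤2 v)) ,
  λ v merge≡0 → let (w , v~w , two) = x-zero v (merge≡0⇒≡0 (x v) (y v) merge≡0)
                in w , v~w , merge≡2 (x≤2 w) two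

supports≤ : ∀ x y → x ≤ 2 → y ≤ 2 → 1 ⊓ merge x y + 1 ⊓ merge y x ≤ x + y
supports≤ 0 0 _ _ = ≤ᵇ⇒≤ _ _ _
supports≤ 0 1 _ _ = ≤ᵇ⇒≤ _ _ _
supports≤ 0 2 _ _ = ≤ᵇ⇒≤ _ _ _
supports≤ 1 0 _ _ = ≤ᵇ⇒≤ _ _ _
supports≤ 1 1 _ _ = ≤ᵇ⇒≤ _ _ _
supports≤ 1 2 _ _ = ≤ᵇ⇒≤ _ _ _
supports≤ 2 0 _ _ = ≤ᵇ⇒≤ _ _ _
supports≤ 2 1 _ _ = ≤ᵇ⇒≤ _ _ _
supports≤ 2 2 _ _ = ≤ᵇ⇒≤ _ _ _
supports≤ (suc (suc (suc _))) _ (s≤s (s≤s ())) _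
supports≤ _ (suc (suc (suc _))) _ (s≤s (s≤s ()))

supports< : ∀ x y → 1 ≤ x → x ≤ 2 → y ≡ 2 → 1 ⊓ merge x y + 1 ⊓ merge y x + 1 ≤ x + y
supports< 1 2 _ _ refl = ≤ᵇ⇒≤ _ _ _
supports< 2 2 _ _ refl = ≤ᵇ⇒≤ _ _ _
supports< (suc (suc (suc _))) _ _ (s≤s (s≤s ())) _

module LowerBound {n} {G : Graph n} {g r}
  (γ≡g : IsDominationNumber G g) (γR≡r : IsRomanDominationNumber G r) (r<2g : r < 2 * g)
  {H : MVertex n → ℕ} (H-rdf : IsRDFᵐ G H) where

  H≤2 : ∀ m → H m ≤ 2
  H≤2 = proj₁ H-rdf

  H-zero : ∀ m → H m ≡ 0 → ∃ λ m′ → T (madj G m m′) × H m′ ≡ 2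
  H-zero = proj₂ H-rdf

  a b ab : Fin n → ℕ
  a j = H (v0 j)
  b j = H (v1 j)
  ab j = a j + b j

  zero-v0 : ∀ j → a j ≡ 0 → ∃ λ w → Adj G j w × (a w ≡ 2 ⊎ b w ≡ 2)
  zero-v0 j aj≡0 with H-zero (v0 j) aj≡0
  ... | v0 w , j~w , aw≡2 = w , j~w , inj₁ aw≡2
  ... | v1 w , j~w , bw≡2 = w , j~w , inj₂ bw≡2

  zero-v1 : H u ≢ 2 → ∀ j → b j ≡ 0 → ∃ λ w → Adj G j w × a w ≡ 2
  zero-v1 Hu≢2 j bj≡0 with H-zero (v1 j) bj≡0
  ... | u    , _    , Hu≡2  = ⊥-elim (Hu≢2 Hu≡2)
  ... | v0 w , j~w , aw≡2 = w , j~w , aw≡2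

  zero-u : H u ≡ 0 → ∃ λ t → b t ≡ 2
  zero-u Hu≡0 with H-zero u Hu≡0
  ... | v1 t , _ , bt≡2 = t , bt≡2

  α β : Fin n → ℕ
  α j = merge (a j) (b j)
  β j = merge (b j) (a j)

  α-rdf : IsRDF G α
  α-rdf = merge-rdf G (H≤2 ∘ v0) zero-v0

  β-rdf : H u ≢ 2 → IsRDF G β
  β-rdf Hu≢2 = merge-rdf G (H≤2 ∘ v1) λ j bj≡0 →
    let (w , j~w , aw≡2) = zero-v1 Hu≢2 j bj≡0 in w , j~w , inj₂ aw≡2

  α≤ab : ∀ j → α j ≤ ab j
  α≤ab j = merge≤+ (a j) (b j)

  β≤ab : ∀ j → β j ≤ ab j
  β≤ab j = subst (β j ≤_) (+-comm (b j) (a j)) (merge≤+ (b j) (a j))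

  r≤sum : ∀ {f} → IsRDF G f → r ≤ sum f
  r≤sum {f} f-rdf = subst (r ≤_) (weight≡sum f) (proj₂ γR≡r f f-rdf)

  supports : Fin n → ℕ
  supports j = 1 ⊓ α j + 1 ⊓ β j

  supports≤ab : ∀ j → supports j ≤ ab j
  supports≤ab j = supports≤ (a j) (b j) (H≤2 (v0 j)) (H≤2 (v1 j))

  2γ≤sum-supports : H u ≢ 2 → 2 * g ≤ sum supports
  2γ≤sum-supports Hu≢2 = begin
    2 * g                                        ≡⟨ cong (g +_) (+-identityʳ g) ⟩
    g + g                                        ≤⟨ +-mono-≤ (γ≤∣support∣ {G = G} {f = α} γ≡g α-rdf) (γ≤∣support∣ {G = G} {f = β} γ≡g (β-rdf Hu≢2)) ⟩
    sum (λ j → 1 ⊓ α j) + sum (λ j → 1 ⊓ β j)   ≡⟨ ∑-distrib-+ (λ j → 1 ⊓ α j) (λ j → 1 ⊓ β j) ⟨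
    sum supports                                 ∎
    where open ≤-Reasoning

  r+1≤2γ : r + 1 ≤ 2 * g
  r+1≤2γ = subst (_≤ 2 * g) (+-comm 1 r) r<2g

  β-without : Fin n → Fin n → ℕ
  β-without t = updateAt β t (const 0)

  β-without-rdf : H u ≢ 2 → ∀ t → a t ≡ 0 → IsRDF G (β-without t)
  β-without-rdf Hu≢2 t at≡0 = β-without≤2 , β-without-zero
    where
    off-t : ∀ {v} → v ≢ t → β-without t v ≡ β v
    off-t {v} v≢t = updateAt-minimal v t β v≢t
    β-without≤2 : ∀ v → β-without t v ≤ 2
    β-without≤2 v with v ≟ᶠ t
    ... | yes refl = subst (_≤ 2) (sym (updateAt-updates t β)) z≤n
    ... | no v≢t   = subst (_≤ 2) (sym (off-t v≢t)) (merge≤2 (a v) (H≤2 (v1 v)))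
    two-off-t : ∀ w → w ≢ t → b w ≡ 2 ⊎ a w ≡ 2 → β-without t w ≡ 2
    two-off-t w w≢t two = trans (off-t w≢t) (merge≡2 (H≤2 (v1 w)) two)
    β-without-zero : ∀ v → β-without t v ≡ 0 → ∃ λ w → Adj G v w × β-without t w ≡ 2
    β-without-zero v βv≡0 with v ≟ᶠ t
    ... | yes refl = let (w , t~w , two) = zero-v0 t at≡0
                     in w , t~w , two-off-t w (adj⇒≢ G t~w ∘ sym) (swap two)
    ... | no v≢t   = let (w , v~w , aw≡2) = zero-v1 Hu≢2 v (merge≡0⇒≡0 (b v) (a v) (trans (sym (off-t v≢t)) βv≡0))
                     in w , v~w , two-off-t w (λ w≡t → case trans (sym at≡0) (subst (λ x → a x ≡ 2) w≡t aw≡2) of λ ()) (inj₂ aw≡2)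

  bound-u0 : H u ≢ 2 → ∀ t → b t ≡ 2 → r + 2 ≤ sum ab
  bound-u0 Hu≢2 t bt≡2 with a t in at
  ... | zero = begin
    r + 2                    ≤⟨ +-monoˡ-≤ 2 (r≤sum (β-without-rdf Hu≢2 t at)) ⟩
    sum (β-without t) + 2    ≡⟨ cong (sum (β-without t) +_) (merge≡2 (H≤2 (v1 t)) (inj₁ bt≡2)) ⟨
    sum (β-without t) + β t  ≡⟨ sum-updateAt-0 β t ⟩
    sum β                    ≤⟨ sum-mono-≤ β≤ab ⟩
    sum ab                   ∎
    where open ≤-Reasoning
  ... | suc k = begin
    r + 2                ≡⟨ +-assoc r 1 1 ⟨
    r + 1 + 1            ≤⟨ +-monoˡ-≤ 1 (≤-trans r+1≤2γ (2γ≤sum-supports Hu≢2)) ⟩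
    sum supports + 1     ≤⟨ sum-mono-≤-at t supports≤ab (supports< (a t) (b t) 1≤at (H≤2 (v0 t)) bt≡2) ⟩
    sum ab               ∎
    where open ≤-Reasoning
          1≤at : 1 ≤ a t
          1≤at = subst (1 ≤_) (sym at) (s≤s z≤n)

  bound : r + 2 ≤ H u + sum ab
  bound with H u in Hu | H≤2 u
  ... | 0 | _ = let (t , bt≡2) = zero-u Hu in bound-u0 (λ Hu≡2 → case trans (sym Hu) Hu≡2 of λ ()) t bt≡2
  ... | 1 | _ = begin
    r + 2            ≡⟨ +-comm r 2 ⟩
    1 + (1 + r)      ≡⟨ cong (1 +_) (+-comm 1 r) ⟩
    1 + (r + 1)      ≤⟨ +-monoʳ-≤ 1 (≤-trans r+1≤2γ (≤-trans (2γ≤sum-supports (λ Hu≡2 → case trans (sym Hu) Hu≡2 of λ ())) (sum-mono-≤ supports≤ab))) ⟩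
    1 + sum ab       ∎
    where open ≤-Reasoning
  ... | 2 | _ = begin
    r + 2            ≡⟨ +-comm r 2 ⟩
    2 + r            ≤⟨ +-monoʳ-≤ 2 (≤-trans (r≤sum α-rdf) (sum-mono-≤ α≤ab)) ⟩
    2 + sum ab       ∎
    where open ≤-Reasoning
  ... | suc (suc (suc _)) | s≤s (s≤s ())

γR+2≤γR[μ] : ∀ {n} {G : Graph n} {g r r′} → IsDominationNumber G g →
             IsRomanDominationNumber G r → r < 2 * g →
             IsRomanDominationNumber (mycielskian G) r′ → r + 2 ≤ r′
γR+2≤γR[μ] {n} {G} {r = r} {r′} γ≡g γR≡r r<2g ((h , h-rdf , weight≡r′) , _) = begin
  r + 2                                         ≤⟨ LowerBound.bound γ≡g γR≡r r<2g (IsRDF⇒IsRDFᵐ h-rdf) ⟩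
  H u + sum (λ j → H (v0 j) + H (v1 j))         ≡⟨ weight-μ H ⟨
  weight (λ x → H (view x))                     ≡⟨ weight≡sum (λ x → H (view x)) ⟩
  sum (λ x → H (view x))                        ≡⟨ sum-cong-≗ (λ x → cong h (embed-view {n} x)) ⟩
  sum h                                         ≡⟨ trans (sym (weight≡sum h)) weight≡r′ ⟩
  r′                                            ∎
  where
  open ≤-Reasoning
  H : MVertex n → ℕ
  H = h ∘ embed

theorem3 : ∀ {n} (G : Graph n) (g r r′ : ℕ) →
    IsDominationNumber G g →
    IsRomanDominationNumber G r →
    ¬ (r ≡ 2 * g) →
    IsRomanDominationNumber (mycielskian G) r′ →
    r′ ≡ r + 2
theorem3 G g r r′ γ≡g γR≡r not-Roman γR[μ]≡r′ =
  ≤-antisym (γR[μ]≤γR+2 γR≡r γR[μ]≡r′) (γR+2≤γR[μ] γ≡g γR≡r r<2g γR[μ]≡r′)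
  where
  r<2g : r < 2 * g
  r<2g = ≤∧≢⇒< (γR≤2γ {G = G} γ≡g γR≡r) not-Roman
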